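{- Let $G=(V,E)$ be a graph with $n=|V|$, $\pi$ a 2-partition of $V$, $K,t$ nonnegative numbers and $f$ a nonnegative integer with $t+2f<n$, and suppose $c_\pi(v)\le t+f$ for all $v\in V$. Let $U=\{v\in V: c_\pi(v)\ge n-t-f\}$. If there exists a $(K,t)$-feasible flipping set $F\subseteq U$ for $\pi$ with $|F|=f$, then $|U|\le K/(n-t-2f)-f$.
   Context: A 2-partition of $V$ is an unordered pair $\pi=(V_1,V_2)$ with $V_1\cap V_2=\emptyset$, $V_1\cup V_2=V$. Two distinct vertices $u,v$ are in conflict in $\pi$ if they are in the same cluster and $(u,v)\notin E$, or in different clusters and $(u,v)\in E$; $c_\pi(v)$ is the number of vertices in conflict with $v$. Flipping $F\subseteq V$ turns $\pi=(V_1,V_2)$ into $\pi\ominus F=(V_1\ominus F,V_2\ominus F)$ ($\ominus$ = symmetric difference). A set $F\subseteq V$ is a $(K,t)$-feasible flipping set for $\pi$ if, with $\pi'=\pi\ominus F$, $\sum_{v\in V}c_{\pi'}(v)\le K$ and $c_{\pi'}(v)\le t$ for every $v\in V$. -}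

module Defs where

open import Data.Nat using (ℕ; _+_; _∸_; _≤_; _≤?_)
open import Data.Nat.ListAction using (sum)
open import Data.Product using (_×_)
open import Data.Bool using (Bool; true; false; not; _xor_; if_then_else_; _∧_; _∨_)
open import Data.Fin using (Fin; _≟_)
open import Data.List using (List; map)
open import Data.List.Base using (allFin)
open import Relation.Nullary using (¬_; does)
open import Relation.Binary.PropositionalEquality using (_≡_)

record Graph (n : ℕ) : Set where
  field
    adj   : Fin n → Fin n → Bool
    sym   : ∀ u v → adj u v ≡ adj v u
    irrefl : ∀ v → adj v v ≡ false
open Graph public

VSubset : ℕ → Set
VSubset n = Fin n → Bool

card : ∀ {n} → VSubset n → ℕ
card {n} S = sum (map (λ v → if S v then 1 else 0) (allFin n))

sumV : ∀ {n} → (Fin n → ℕ) → ℕ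
sumV {n} f = sum (map f (allFin n))

-- A 2-partition (V₁,V₂) is represented by the indicator of V₁
-- (V₂ is its complement). The unordered pair corresponds to the
-- choice of side up to swapping, and all notions below are invariant
-- under swapping true/false.
Partition : ℕ → Set
Partition n = Fin n → Bool

sameCluster : ∀ {n} → Partition n → Fin n → Fin n → Bool
sameCluster π u v = not (π u xor π v)

inConflict : ∀ {n} → Graph n → Partition n → Fin n → Fin n → Bool
inConflict G π u v =
  if does (u ≟ v) then false
  else ((sameCluster π u v ∧ not (adj G u v)) ∨ (not (sameCluster π u v) ∧ adj G u v))

conflicts : ∀ {n} → Graph n → Partition n → Fin n → ℕ
conflicts G π v = card (λ u → inConflict G π u v)

flip : ∀ {n} → Partition n → VSubset n → Partition n
flip π F v = π v xor F v

Feasible : ∀ {n} → Graph n → Partition n → ℕ → ℕ → VSubset n → Set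
Feasible G π K t F =
  (sumV (conflicts G (flip π F)) ≤ K) × (∀ v → conflicts G (flip π F) v ≤ t)

highConflict : ∀ {n} → Graph n → Partition n → ℕ → ℕ → VSubset n
highConflict {n} G π t f v = does ((n ∸ t ∸ f) ≤? conflicts G π v)

_⊆_ : ∀ {n} → VSubset n → VSubset n → Set
A ⊆ B = ∀ v → A v ≡ true → B v ≡ true

-- Let π′ = π ⊖ F and m = n − t − 2f. Every w ∈ U ∪ F is in π′-conflict with at least m
-- unflipped vertices: a flipped w is in π′-conflict with every unflipped vertex it was not in
-- π-conflict with, and there are at least n − f − (t + f) of those; an unflipped w ∈ U keeps
-- its π-conflicts with unflipped vertices, at least (n − t − f) − f of them. Counting the
-- π′-conflicts of each vertex with unflipped vertices gives at least |U|·m, and counting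
-- those with flipped vertices from the flipped side gives at least f·m more, so
-- (|U| + f)·m ≤ Σ c_π′ ≤ K.
module Submission where

open import Defs hiding (sym)
open import Algebra.Bundles using (CommutativeRing)
open import Data.Nat using (ℕ; zero; suc; _+_; _*_; _∸_; _≤_; _<_; z≤n; s≤s)
open import Data.Nat.Properties
  using (+-*-semiring; ≤-trans; ≤-reflexive; +-mono-≤; +-identityʳ; *-identityˡ;
         *-distribʳ-+; *-monoʳ-≤; +-comm; ≤ᵇ⇒≤; m≤m+n; m≤n+o⇒m∸n≤o; ∸-+-assoc; module ≤-Reasoning)
open import Data.Nat.ListAction using () renaming (sum to sumL)
open import Data.Product using (Σ; _×_; _,_)
open import Data.Bool using (Bool; true; false; not; _xor_; if_then_else_; _∧_; _∨_)
open import Data.Bool.Properties using (xor-∧-commutativeRing; xor-comm; xor-same; not-distribˡ-xor; ∨-identityʳ; T-≡)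
open import Data.Fin using (Fin; zero; suc; _≟_)
open import Relation.Nullary using (yes; no)
open import Data.List using (tabulate)
open import Data.List.Properties using (map-tabulate)
open import Function using (_∘_; Equivalence)
open import Relation.Binary.PropositionalEquality using (_≡_; refl; sym; trans; cong; cong₂; module ≡-Reasoning)
open import Algebra.Properties.Semiring.Sum +-*-semiring
  using (sum-syntax; sum-cong-≗; sum-replicate-zero; ∑-distrib-+; ∑-comm; *-distribʳ-sum)
open import Algebra.Properties.CommutativeSemigroup
  (CommutativeRing.+-commutativeSemigroup xor-∧-commutativeRing)
  using (interchange; xy∙z≈xz∙y)

χ : Bool → ℕ
χ b = if b then 1 else 0

sumV≡∑ : ∀ {n} (f : Fin n → ℕ) → sumV f ≡ ∑[ v < n ] f v
sumV≡∑ {n} f = trans (cong sumL (map-tabulate (λ v → v) f)) (sum-tabulate n f)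
  where
  sum-tabulate : ∀ n (f : Fin n → ℕ) → sumL (tabulate f) ≡ ∑[ v < n ] f v
  sum-tabulate zero    f = refl
  sum-tabulate (suc n) f = cong (f zero +_) (sum-tabulate n (f ∘ suc))

card≡∑ : ∀ {n} (S : VSubset n) → card S ≡ ∑[ v < n ] χ (S v)
card≡∑ S = sumV≡∑ (χ ∘ S)

∑-mono-≤ : ∀ {n} {f g : Fin n → ℕ} → (∀ i → f i ≤ g i) → ∑[ i < n ] f i ≤ ∑[ i < n ] g i
∑-mono-≤ {zero}  f≤g = z≤n
∑-mono-≤ {suc n} f≤g = +-mono-≤ (f≤g zero) (∑-mono-≤ (f≤g ∘ suc))

∑-const-1 : ∀ n → ∑[ i < n ] 1 ≡ n
∑-const-1 zero    = refl
∑-const-1 (suc n) = cong suc (∑-const-1 n)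

m∸n≤n+o⇒m∸2*n≤o : ∀ a f h → a ∸ f ≤ f + h → a ∸ 2 * f ≤ h
m∸n≤n+o⇒m∸2*n≤o a f h a∸f≤f+h = begin
  a ∸ 2 * f     ≡⟨ cong (λ k → a ∸ (f + k)) (+-identityʳ f) ⟩
  a ∸ (f + f)   ≡⟨ sym (∸-+-assoc a f f) ⟩
  a ∸ f ∸ f     ≤⟨ m≤n+o⇒m∸n≤o (a ∸ f) f a∸f≤f+h ⟩
  h             ∎
  where open ≤-Reasoning

χ-*-≤ : ∀ b x → χ b * x ≤ x
χ-*-≤ true  x = ≤-reflexive (*-identityˡ x)
χ-*-≤ false x = z≤n

χ-*-monoʳ-≤ : ∀ b {x y} → (b ≡ true → x ≤ y) → χ b * x ≤ χ b * y
χ-*-monoʳ-≤ true  x≤y = *-monoʳ-≤ 1 (x≤y refl)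
χ-*-monoʳ-≤ false x≤y = z≤n

χ-split : ∀ s b → χ b ≡ χ (not s ∧ b) + χ (s ∧ b)
χ-split true  b = refl
χ-split false b = sym (+-identityʳ (χ b))

disagree≡xor : ∀ s a → (s ∧ not a) ∨ (not s ∧ a) ≡ s xor a
disagree≡xor true  a = ∨-identityʳ (not a)
disagree≡xor false a = refl

module _ {n} (G : Graph n) where

  inConflict-sym : ∀ (ρ : Partition n) u v → inConflict G ρ u v ≡ inConflict G ρ v u
  inConflict-sym ρ u v with u ≟ v | v ≟ u
  ... | yes refl | yes _    = refl
  ... | yes refl | no  v≢v  with () ← v≢v refl
  ... | no  u≢u  | yes refl with () ← u≢u refl
  ... | no  _    | no  _    = cong₂ (λ s a → (s ∧ not a) ∨ (not s ∧ a))
                                    (cong not (xor-comm (ρ u) (ρ v))) (Graph.sym G u v)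

  sameCluster-flip : ∀ (π : Partition n) F u v → sameCluster (flip π F) u v ≡ sameCluster π u v xor (F u xor F v)
  sameCluster-flip π F u v = trans (cong not (interchange (π u) (F u) (π v) (F v)))
                                   (not-distribˡ-xor (π u xor π v) (F u xor F v))

  inConflict-flip : ∀ (π : Partition n) F u v → inConflict G (flip π F) u v ≡ inConflict G π u v xor (F u xor F v)
  inConflict-flip π F u v with u ≟ v
  ... | yes refl = sym (xor-same (F u))
  ... | no  _    = begin
    disagree (sameCluster (flip π F) u v)
      ≡⟨ disagree≡xor (sameCluster (flip π F) u v) (adj G u v) ⟩
    sameCluster (flip π F) u v xor adj G u v
      ≡⟨ cong (_xor adj G u v) (sameCluster-flip π F u v) ⟩
    (sameCluster π u v xor (F u xor F v)) xor adj G u v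
      ≡⟨ xy∙z≈xz∙y (sameCluster π u v) (F u xor F v) (adj G u v) ⟩
    (sameCluster π u v xor adj G u v) xor (F u xor F v)
      ≡⟨ cong (_xor (F u xor F v)) (sym (disagree≡xor (sameCluster π u v) (adj G u v))) ⟩
    disagree (sameCluster π u v) xor (F u xor F v)
      ∎
    where
    open ≡-Reasoning
    disagree : Bool → Bool
    disagree s = (s ∧ not (adj G u v)) ∨ (not s ∧ adj G u v)

  conflicts≡∑ : ∀ ρ w → conflicts G ρ w ≡ ∑[ u < n ] χ (inConflict G ρ u w)
  conflicts≡∑ ρ w = card≡∑ (λ u → inConflict G ρ u w)

  conflictsIn : Partition n → VSubset n → Fin n → ℕ
  conflictsIn ρ S w = ∑[ u < n ] χ (S u ∧ inConflict G ρ u w)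

  conflicts-split : ∀ ρ S w → conflicts G ρ w ≡ conflictsIn ρ (not ∘ S) w + conflictsIn ρ S w
  conflicts-split ρ S w = begin
    conflicts G ρ w                                                ≡⟨ conflicts≡∑ ρ w ⟩
    ∑[ u < n ] χ (inConflict G ρ u w)
      ≡⟨ sum-cong-≗ (λ u → χ-split (S u) (inConflict G ρ u w)) ⟩
    ∑[ u < n ] (χ (not (S u) ∧ inConflict G ρ u w) + χ (S u ∧ inConflict G ρ u w))
      ≡⟨ ∑-distrib-+ (λ u → χ (not (S u) ∧ inConflict G ρ u w)) (λ u → χ (S u ∧ inConflict G ρ u w)) ⟩
    conflictsIn ρ (not ∘ S) w + conflictsIn ρ S w                  ∎
    where open ≡-Reasoning

  ∑-conflictsIn : ∀ ρ S → ∑[ w < n ] conflictsIn ρ S w ≡ ∑[ u < n ] (χ (S u) * conflicts G ρ u)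
  ∑-conflictsIn ρ S = trans (∑-comm (λ w u → χ (S u ∧ inConflict G ρ u w))) (sum-cong-≗ weight)
    where
    ∑-χ-∧ : ∀ b (g : Fin n → Bool) → ∑[ w < n ] χ (b ∧ g w) ≡ χ b * ∑[ w < n ] χ (g w)
    ∑-χ-∧ true  g = sym (*-identityˡ _)
    ∑-χ-∧ false g = sum-replicate-zero n
    weight : ∀ u → ∑[ w < n ] χ (S u ∧ inConflict G ρ u w) ≡ χ (S u) * conflicts G ρ u
    weight u = begin
      ∑[ w < n ] χ (S u ∧ inConflict G ρ u w)   ≡⟨ ∑-χ-∧ (S u) (inConflict G ρ u) ⟩
      χ (S u) * ∑[ w < n ] χ (inConflict G ρ u w)
        ≡⟨ cong (χ (S u) *_) (sum-cong-≗ (λ w → cong χ (inConflict-sym ρ u w))) ⟩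
      χ (S u) * ∑[ w < n ] χ (inConflict G ρ w u) ≡⟨ cong (χ (S u) *_) (sym (conflicts≡∑ ρ u)) ⟩
      χ (S u) * conflicts G ρ u                  ∎
      where open ≡-Reasoning

  module Flipping (π : Partition n) (F : VSubset n) where

    π′ : Partition n
    π′ = flip π F

    unflippedConflicts : Fin n → ℕ
    unflippedConflicts = conflictsIn π′ (not ∘ F)

    flipped-cover : ∀ {w} → F w ≡ true → ∀ u →
      1 ≤ χ (F u) + χ (not (F u) ∧ inConflict G π′ u w) + χ (inConflict G π u w)
    flipped-cover {w} Fw u rewrite inConflict-flip π F u w | Fw = cover (F u) (inConflict G π u w)
      where
      cover : ∀ f c → 1 ≤ χ f + χ (not f ∧ (c xor (f xor true))) + χ c
      cover true  c     = s≤s z≤n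
      cover false true  = s≤s z≤n
      cover false false = s≤s z≤n

    unflipped-cover : ∀ {w} → F w ≡ false → ∀ u →
      χ (inConflict G π u w) ≤ χ (F u) + χ (not (F u) ∧ inConflict G π′ u w)
    unflipped-cover {w} Fw u rewrite inConflict-flip π F u w | Fw = cover (F u) (inConflict G π u w)
      where
      cover : ∀ f c → χ c ≤ χ f + χ (not f ∧ (c xor (f xor false)))
      cover true  true  = s≤s z≤n
      cover true  false = z≤n
      cover false true  = s≤s z≤n
      cover false false = z≤n

    flipped-bound : ∀ {w} → F w ≡ true → n ≤ card F + unflippedConflicts w + conflicts G π w
    flipped-bound {w} Fw = begin
      n                                                ≡⟨ sym (∑-const-1 n) ⟩
      ∑[ u < n ] 1                                     ≤⟨ ∑-mono-≤ (flipped-cover Fw) ⟩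
      ∑[ u < n ] (χ (F u) + χ (not (F u) ∧ inConflict G π′ u w) + χ (inConflict G π u w))
        ≡⟨ ∑-distrib-+ (λ u → χ (F u) + χ (not (F u) ∧ inConflict G π′ u w)) (λ u → χ (inConflict G π u w)) ⟩
      ∑[ u < n ] (χ (F u) + χ (not (F u) ∧ inConflict G π′ u w)) + ∑[ u < n ] χ (inConflict G π u w)
        ≡⟨ cong₂ _+_ (∑-distrib-+ (λ u → χ (F u)) (λ u → χ (not (F u) ∧ inConflict G π′ u w)))
                     (sym (conflicts≡∑ π w)) ⟩
      ∑[ u < n ] χ (F u) + unflippedConflicts w + conflicts G π w
        ≡⟨ cong (λ c → c + unflippedConflicts w + conflicts G π w) (sym (card≡∑ F)) ⟩
      card F + unflippedConflicts w + conflicts G π w  ∎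
      where open ≤-Reasoning

    unflipped-bound : ∀ {w} → F w ≡ false → conflicts G π w ≤ card F + unflippedConflicts w
    unflipped-bound {w} Fw = begin
      conflicts G π w                          ≡⟨ conflicts≡∑ π w ⟩
      ∑[ u < n ] χ (inConflict G π u w)         ≤⟨ ∑-mono-≤ (unflipped-cover Fw) ⟩
      ∑[ u < n ] (χ (F u) + χ (not (F u) ∧ inConflict G π′ u w))
        ≡⟨ ∑-distrib-+ (λ u → χ (F u)) (λ u → χ (not (F u) ∧ inConflict G π′ u w)) ⟩
      ∑[ u < n ] χ (F u) + unflippedConflicts w ≡⟨ cong (_+ unflippedConflicts w) (sym (card≡∑ F)) ⟩
      card F + unflippedConflicts w            ∎
      where open ≤-Reasoning

    module _ {t f : ℕ} (|F|≡f : card F ≡ f) (c≤t+f : ∀ v → conflicts G π v ≤ t + f) where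

      U : VSubset n
      U = highConflict G π t f

      margin : ℕ
      margin = n ∸ t ∸ 2 * f

      margin≤unflippedConflicts-flipped : ∀ {w} → F w ≡ true → margin ≤ unflippedConflicts w
      margin≤unflippedConflicts-flipped {w} Fw = m∸n≤n+o⇒m∸2*n≤o (n ∸ t) f (unflippedConflicts w) (begin
        n ∸ t ∸ f                      ≡⟨ ∸-+-assoc n t f ⟩
        n ∸ (t + f)                    ≤⟨ m≤n+o⇒m∸n≤o n (t + f) n≤t+f+[f+h] ⟩
        f + unflippedConflicts w       ∎)
        where
        open ≤-Reasoning
        n≤t+f+[f+h] : n ≤ t + f + (f + unflippedConflicts w)
        n≤t+f+[f+h] = begin
          n                                                ≤⟨ flipped-bound Fw ⟩
          card F + unflippedConflicts w + conflicts G π w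
            ≤⟨ +-mono-≤ (≤-reflexive (cong (_+ unflippedConflicts w) |F|≡f)) (c≤t+f w) ⟩
          f + unflippedConflicts w + (t + f)               ≡⟨ +-comm (f + unflippedConflicts w) (t + f) ⟩
          t + f + (f + unflippedConflicts w)               ∎

      margin≤unflippedConflicts-high : ∀ {w} → F w ≡ false → U w ≡ true → margin ≤ unflippedConflicts w
      margin≤unflippedConflicts-high {w} Fw Uw = m∸n≤n+o⇒m∸2*n≤o (n ∸ t) f (unflippedConflicts w) (begin
        n ∸ t ∸ f                      ≤⟨ ≤ᵇ⇒≤ (n ∸ t ∸ f) (conflicts G π w) (Equivalence.from T-≡ Uw) ⟩
        conflicts G π w                ≤⟨ unflipped-bound Fw ⟩
        card F + unflippedConflicts w  ≡⟨ cong (_+ unflippedConflicts w) |F|≡f ⟩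
        f + unflippedConflicts w       ∎)
        where open ≤-Reasoning

      margin≤unflippedConflicts : ∀ {w} → U w ≡ true → margin ≤ unflippedConflicts w
      margin≤unflippedConflicts {w} Uw = by-side (F w) refl
        where
        by-side : ∀ b → F w ≡ b → margin ≤ unflippedConflicts w
        by-side true  Fw = margin≤unflippedConflicts-flipped Fw
        by-side false Fw = margin≤unflippedConflicts-high Fw Uw

      weighted-count : (card U + f) * margin ≤ sumV (conflicts G π′)
      weighted-count = begin
        (card U + f) * margin
          ≡⟨ *-distribʳ-+ margin (card U) f ⟩
        card U * margin + f * margin
          ≡⟨ cong₂ (λ a b → a * margin + b * margin) (card≡∑ U) (trans (sym |F|≡f) (card≡∑ F)) ⟩
        (∑[ w < n ] χ (U w)) * margin + (∑[ u < n ] χ (F u)) * margin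
          ≡⟨ cong₂ _+_ (*-distribʳ-sum margin (χ ∘ U)) (*-distribʳ-sum margin (χ ∘ F)) ⟩
        ∑[ w < n ] (χ (U w) * margin) + ∑[ u < n ] (χ (F u) * margin)
          ≤⟨ +-mono-≤ (∑-mono-≤ high-weight) (∑-mono-≤ flipped-weight) ⟩
        ∑[ w < n ] unflippedConflicts w + ∑[ u < n ] (χ (F u) * conflicts G π′ u)
          ≡⟨ cong (∑[ w < n ] unflippedConflicts w +_) (sym (∑-conflictsIn π′ F)) ⟩
        ∑[ w < n ] unflippedConflicts w + ∑[ w < n ] conflictsIn π′ F w
          ≡⟨ sym (∑-distrib-+ unflippedConflicts (conflictsIn π′ F)) ⟩
        ∑[ w < n ] (unflippedConflicts w + conflictsIn π′ F w)
          ≡⟨ sym (trans (sumV≡∑ (conflicts G π′)) (sum-cong-≗ (conflicts-split π′ F))) ⟩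
        sumV (conflicts G π′)
          ∎
        where
        open ≤-Reasoning
        high-weight : ∀ w → χ (U w) * margin ≤ unflippedConflicts w
        high-weight w = ≤-trans (χ-*-monoʳ-≤ (U w) margin≤unflippedConflicts) (χ-*-≤ (U w) (unflippedConflicts w))
        flipped-weight : ∀ u → χ (F u) * margin ≤ χ (F u) * conflicts G π′ u
        flipped-weight u = χ-*-monoʳ-≤ (F u) λ Fu → begin
          margin                                          ≤⟨ margin≤unflippedConflicts-flipped Fu ⟩
          unflippedConflicts u                            ≤⟨ m≤m+n (unflippedConflicts u) (conflictsIn π′ F u) ⟩
          unflippedConflicts u + conflictsIn π′ F u       ≡⟨ sym (conflicts-split π′ F u) ⟩
          conflicts G π′ u                                ∎

lemma4 : ∀ (n : ℕ) (G : Graph n) (π : Partition n) (K t f : ℕ)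
             → t + 2 * f < n
             → (∀ v → conflicts G π v ≤ t + f)
             → Σ (VSubset n) (λ F → (F ⊆ highConflict G π t f) × (card F ≡ f) × Feasible G π K t F)
             → (card (highConflict G π t f) + f) * (n ∸ t ∸ 2 * f) ≤ K
lemma4 n G π K t f _ c≤t+f (F , _ , |F|≡f , total≤K , _) =
  ≤-trans (Flipping.weighted-count G π F |F|≡f c≤t+f) total≤K
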